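{- There exist an AMAS $S$, a coalition $A$ with a joint strategy $\sigma_A$ in $S$, and a path $\pi=g_0e_0g_1e_1\dots$ in $\mathrm{IIS}^{\epsilon}(S)$ containing only finitely many events different from $\epsilon$ (i.e., $e_j=\epsilon$ for all $j$ from some point on), such that $\pi$ is concurrency-fair for $\sigma_A$ and $g_0$.
   Context: An AMAS $S$ consists of agents $\mathbb{A}\mathrm{gt}=\{1,\dots,n\}$; each agent $i$ has a finite set of local states $L_i$, an initial state $\iota_i$, a finite set of events $\Sigma_i$, a repertoire $R_i:L_i\to 2^{\Sigma_i}\setminus\{\emptyset\}$, and a partial local transition function $T_i:L_i\times\Sigma_i\rightharpoonup L_i$ defined iff $e\in R_i(l)$. $Agent(e)=\{i\mid e\in\Sigma_i\}$. The model $\mathrm{IIS}(S)$ has global states reachable from $(\iota_1,\dots,\iota_n)$ via $T(g,e)=g'$ iff $T_i(g^i,e)=g'^i$ for $i\in Agent(e)$ and $g'^i=g^i$ otherwise; $enabled(g)$ is the set of $e$ with $T(g,e)$ defined; $T$ is assumed serial. A strategy of agent $i$ is $\sigma_i:L_i\to\Sigma_i$ with $\sigma_i(l)\in R_i(l)$; $\sigma_A(g)=(\sigma_i(g^i))_{i\in A}$. For choices $\vec e_A$, $e_i\in R_i(g^i)$, $enabled_{\mathrm{IIS}(S)}(g,\vec e_A)$ is the set of $b\in enabled(g)$ with $b=e_i$ for all $i\in Agent(b)\cap A$ and $b\in R_i(g^i)$ for all $i\in Agent(b)\setminus A$. The undeadlocked model $\mathrm{IIS}^{\epsilon}(S)$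 adds a fresh event $\epsilon$ with $Agent(\epsilon)=\emptyset$ as a self-loop at every state $g$ where some coalition has a choice tuple $\vec e_A$ with $enabled_{\mathrm{IIS}(S)}(g,\vec e_A)=\emptyset$; for such tuples $enabled_{\mathrm{IIS}^{\epsilon}(S)}(g,\vec e_A)=\{\epsilon\}$, otherwise it equals $enabled_{\mathrm{IIS}(S)}(g,\vec e_A)$. A path is an infinite sequence $g_0e_0g_1\dots$ with $g_k\xrightarrow{e_k}g_{k+1}$. A path $\pi$ is concurrency-fair for strategy $\sigma_A$ and state $g$ iff $g_0=g$ and there is no event $e$ and no $n$ such that for all $i\ge n$: $e\in enabled(g_i,\sigma_A(g_i))$ and $Agent(e)\cap Agent(e_i)=\emptyset$. -}

module Defs where

open import Data.Nat using (ℕ; suc; _≥_)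
open import Data.Fin using (Fin)
open import Data.Bool using (Bool; true; false)
open import Data.Maybe using (Maybe; just; nothing)
open import Data.Product using (Σ; ∃; _×_; _,_)
open import Data.Empty using (⊥)
open import Relation.Nullary using (¬_)
open import Relation.Binary.PropositionalEquality using (_≡_)

-- Events form the finite set Fin nE; agent i's event set Σ_i is given
-- by the characteristic function Sig i.
record AMAS : Set where
  field
    n    : ℕ
    nE   : ℕ
    nL   : Fin n → ℕ
    ι    : (i : Fin n) → Fin (nL i)
    Sig  : Fin n → Fin nE → Bool
    -- the global event set is the union of the Σ_i
    owned : (e : Fin nE) → ∃ λ i → Sig i e ≡ true
    -- repertoire R_i : L_i → 2^{Σ_i} \ {∅}
    R    : (i : Fin n) → Fin (nL i) → Fin nE → Bool
    R⊆Σ  : ∀ i l e → R i l e ≡ true → Sig i e ≡ true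
    R≠∅  : ∀ i l → ∃ λ e → R i l e ≡ true
    T    : (i : Fin n) → Fin (nL i) → Fin nE → Maybe (Fin (nL i))
    T-def : ∀ i l e → R i l e ≡ true → ∃ λ l' → T i l e ≡ just l'
    T-undef : ∀ i l e → R i l e ≡ false → T i l e ≡ nothing

module _ (S : AMAS) where
  open AMAS S

  Event : Set
  Event = Fin nE

  GState : Set
  GState = (i : Fin n) → Fin (nL i)

  InAgent : Event → Fin n → Set
  InAgent e i = Sig i e ≡ true

  Step : GState → Event → GState → Set
  Step g e g' = ∀ i → (Sig i e ≡ true → T i (g i) e ≡ just (g' i))
                    × (Sig i e ≡ false → g' i ≡ g i)

  initial : GState
  initial = ι

  data Reachable : GState → Set where
    init : Reachable initial
    step : ∀ {g e g'} → Reachable g → Step g e g' → Reachable g'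

  enabled : GState → Event → Set
  enabled g e = ∃ λ g' → Step g e g'

  Serial : Set
  Serial = ∀ g → Reachable g → ∃ λ e → enabled g e

  Coalition : Set
  Coalition = Fin n → Bool

  -- a choice tuple for A, represented as a function on all agents of which
  -- only the entries for i ∈ A matter
  Choice : Set
  Choice = Fin n → Event

  ValidChoice : GState → Coalition → Choice → Set
  ValidChoice g A c = ∀ i → A i ≡ true → R i (g i) (c i) ≡ true

  enabledCh : GState → Coalition → Choice → Event → Set
  enabledCh g A c b = enabled g b
    × (∀ i → Sig i b ≡ true → A i ≡ true → b ≡ c i)
    × (∀ i → Sig i b ≡ true → A i ≡ false → R i (g i) b ≡ true)

  Strategy : Set
  Strategy = (i : Fin n) → Fin (nL i) → Event

  ValidStrategy : Coalition → Strategy → Set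
  ValidStrategy A σ = ∀ i → A i ≡ true → ∀ l → R i l (σ i l) ≡ true

  applyStrat : Strategy → GState → Choice
  applyStrat σ g i = σ i (g i)

  -- IIS^ε(S): events are Maybe Event, with nothing = ε (Agent(ε) = ∅)
  EEvent : Set
  EEvent = Maybe Event

  NeedsEps : GState → Set
  NeedsEps g = ∃ λ (A : Coalition) → ∃ λ (c : Choice) →
    ValidChoice g A c × (∀ b → ¬ enabledCh g A c b)

  StepE : GState → EEvent → GState → Set
  StepE g (just e) g' = Step g e g'
  StepE g nothing g'  = (g' ≡ g) × NeedsEps g

  InAgentE : EEvent → Fin n → Set
  InAgentE (just e) i = InAgent e i
  InAgentE nothing  i = ⊥

  record PathE : Set where
    field
      st  : ℕ → GState
      ev  : ℕ → EEvent
      st0-reach : Reachable (st 0)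
      steps : ∀ k → StepE (st k) (ev k) (st (suc k))

  FinitelyManyNonEps : PathE → Set
  FinitelyManyNonEps π = ∃ λ N → ∀ j → j ≥ N → PathE.ev π j ≡ nothing

  -- concurrency-fairness for σ_A and g; enabled(g_i, σ_A(g_i)) is
  -- enabled_{IIS(S)}
  ConcFair : Coalition → Strategy → GState → PathE → Set
  ConcFair A σ g π = (PathE.st π 0 ≡ g) ×
    ¬ (∃ λ (e : Event) → ∃ λ (N : ℕ) → ∀ i → i ≥ N →
         enabledCh (PathE.st π i) A (applyStrat σ (PathE.st π i)) e
         × (∀ j → InAgent e j → InAgentE (PathE.ev π i) j → ⊥))

-- A coalition can pick a strategy under which no event is enabled at some
-- state: its own choice excludes every event it takes part in, and an agent
-- outside the coalition refuses the remaining ones.  There IIS^ε(S) can only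
-- loop on ε, and concurrency-fairness holds vacuously, since it only
-- constrains events enabled under the strategy.  Here two agents share both
-- events a and b; the proponent always chooses b, which the opponent cannot
-- perform.
module Submission where

open import Defs
open import Data.Product using (∃; _×_; _,_; proj₁)
open import Data.Nat.Properties using (≤-refl)
open import Data.Fin using (Fin; zero; suc)
open import Data.Bool using (Bool; true; false; if_then_else_)
open import Data.Maybe using (Maybe; just; nothing)
open import Relation.Nullary using (¬_)
open import Relation.Binary.PropositionalEquality using (_≡_; refl)

module _ (S : AMAS) where

  εLoop : ∀ {g} → Reachable S g → NeedsEps S g → PathE S
  εLoop {g} reach needsEps = record
    { st        = λ _ → g
    ; ev        = λ _ → nothing
    ; st0-reach = reach
    ; steps     = λ _ → refl , needsEps
    }

  εLoop-finitelyManyNonEps : ∀ {g} (reach : Reachable S g) (needsEps : NeedsEps S g) →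
                             FinitelyManyNonEps S (εLoop reach needsEps)
  εLoop-finitelyManyNonEps _ _ = 0 , λ _ _ → refl

  module _ (A : Coalition S) (σ : Strategy S) where

    Blocked : GState S → Set
    Blocked g = ∀ b → ¬ enabledCh S g A (applyStrat S σ g) b

    blocked⇒needsEps : ValidStrategy S A σ → ∀ {g} → Blocked g → NeedsEps S g
    blocked⇒needsEps valid {g} blocked =
      A , applyStrat S σ g , (λ i i∈A → valid i i∈A (g i)) , blocked

    εLoop-concFair : ∀ {g} (reach : Reachable S g) (needsEps : NeedsEps S g) → Blocked g →
                     ConcFair S A σ g (εLoop reach needsEps)
    εLoop-concFair _ _ blocked = refl , λ (e , N , always) → blocked e (proj₁ (always N ≤-refl))

pattern proponent = zero
pattern opponent  = suc zero

pattern a = zero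
pattern b = suc zero

repertoire : Fin 2 → Fin 1 → Fin 2 → Bool
repertoire opponent _ b = false
repertoire _        _ _ = true

transition : (i : Fin 2) → Fin 1 → Fin 2 → Maybe (Fin 1)
transition i l e = if repertoire i l e then just l else nothing

a∈repertoire : ∀ i l → repertoire i l a ≡ true
a∈repertoire proponent _ = refl
a∈repertoire opponent  _ = refl

refusal : AMAS
refusal = record
  { n       = 2
  ; nE      = 2
  ; nL      = λ _ → 1
  ; ι       = λ _ → zero
  ; Sig     = λ _ _ → true
  ; owned   = λ _ → proponent , refl
  ; R       = repertoire
  ; R⊆Σ     = λ _ _ _ _ → refl
  ; R≠∅     = λ i l → a , a∈repertoire i l
  ; T       = transition
  ; T-def   = λ _ l _ r → l , defined r
  ; T-undef = λ _ _ _ r → undefined r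
  }
  where
  defined : ∀ {i l e} → repertoire i l e ≡ true → transition i l e ≡ just l
  defined r rewrite r = refl
  undefined : ∀ {i l e} → repertoire i l e ≡ false → transition i l e ≡ nothing
  undefined r rewrite r = refl

a-loop : ∀ g → Step refusal g a g
a-loop g proponent = (λ _ → refl) , λ ()
a-loop g opponent  = (λ _ → refl) , λ ()

refusal-serial : Serial refusal
refusal-serial g _ = a , g , a-loop g

coalition : Coalition refusal
coalition proponent = true
coalition opponent  = false

alwaysB : Strategy refusal
alwaysB _ _ = b

alwaysB-valid : ValidStrategy refusal coalition alwaysB
alwaysB-valid proponent _  _ = refl
alwaysB-valid opponent  () _

alwaysB-blocked : ∀ g → Blocked refusal coalition alwaysB g
alwaysB-blocked g a (_ , a≡choice , _) with a≡choice proponent refl refl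
... | ()
alwaysB-blocked g b ((_ , move) , _) with proj₁ (move opponent) refl
... | ()

mainTheorem6 : ∃ λ (S : AMAS) → Serial S × ∃ λ (A : Coalition S) → ∃ λ (σ : Strategy S) → ValidStrategy S A σ × ∃ λ (π : PathE S) → FinitelyManyNonEps S π × ConcFair S A σ (PathE.st π 0) π
mainTheorem6 =
  refusal , refusal-serial , coalition , alwaysB , alwaysB-valid ,
  εLoop refusal init needsEps ,
  εLoop-finitelyManyNonEps refusal init needsEps ,
  εLoop-concFair refusal coalition alwaysB init needsEps (alwaysB-blocked _)
  where
  needsEps : NeedsEps refusal (initial refusal)
  needsEps = blocked⇒needsEps refusal coalition alwaysB alwaysB-valid (alwaysB-blocked _)
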